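{- Let $n\ge4$, $Q$ an acyclic quiver of type $D_n$, $\underline d\in\Phi_+$ and $\underline e\in\mathbb Z^n$ with $0\le e_k\le d_k$ for all $k$, and let $w$ be the weight function obtained from $M_-$ by performing $e_k$ weighted flips at each tile $k$. Let $\alpha$ be a boundary edge of $G$ (an edge belonging to exactly one tile), lying on tile $i$. If $\alpha$ is black-to-white clockwise with respect to tile $i$, then $w(\alpha)=\max(d_i,0)-e_i$; if $\alpha$ is white-to-black clockwise with respect to tile $i$, then $w(\alpha)=\max(-d_i,0)+e_i$.
   Context: $Q$ is an acyclic orientation of the Dynkin diagram $D_n$ with vertices $0,\dots,n-1$ and edges $\{i,i+1\}$ ($0\le i\le n-4$), $\{n-3,n-2\}$, $\{n-3,n-1\}$. $\Phi_+$: positive roots of type $D_n$ in simple-root coordinates (the $0/1$ indicator vectors of nonempty connected vertex sets, together with $e_i+\dots+e_{j-1}+2e_j+\dots+2e_{n-3}+e_{n-2}+e_{n-1}$, $0\le i<j\le n-3$). Base graph $G$: planar bipartite black/white graph, union of tiles $0,\dots,n-1$ (tile $n-3$ a hexagon, others squares); tiles $i,j$ share an edge iff adjacent in the diagram; for every arrow $i\to j$ the shared edge goes black to white when traversing tile $i$ clockwise; tiles $0,\dots,n-3$ form a snake (for $1\le i\le n-4$, tiles $i\pm1$ on opposite edges of tile $i$ if the arrows at $i$ point in opposite directions, adjacent edges if in the same direction); tiles $n-4,n-2,n-1$ glued to three distinct hexagon edges at positions fixed by a convention depending on orientation. For a union $H$ of tiles, a boundary edge of $H$ is black-to-white clockwise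 if it goes from black to white when the boundary of $H$ is traversed clockwise, white-to-black clockwise otherwise. $M_-=M_1\sqcup M_2$ where $M_1$ (resp. $M_2$) is the set of black-to-white clockwise boundary edges of the union of tiles with $d_i\ge1$ (resp. $d_i=2$); initial weight of an edge = its multiplicity in $M_-$. Weighted flip at tile $i$: decrease by $1$ the weight of each black-to-white clockwise edge of tile $i$ and increase by $1$ the weight of each white-to-black clockwise edge of tile $i$. -}

module Defs where

open import Data.Bool using (Bool; true; false; _∧_; _∨_; if_then_else_)
open import Data.Nat as ℕ using (ℕ; zero; suc; _∸_; _<ᵇ_; _≤ᵇ_; _≡ᵇ_)
open import Data.Fin using (Fin; toℕ; _≟_)
open import Data.List using (List; []; _∷_; _++_; [_]; length; foldr; map; allFin)
open import Data.Nat.ListAction using (sum)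
open import Data.List.Relation.Unary.Unique.Propositional using (Unique)
open import Data.Integer as ℤ using (ℤ; +_; 0ℤ; 1ℤ; _-_; _+_)
open import Data.Product using (_×_; Σ; ∃; _,_)
open import Data.Sum using (_⊎_)
open import Data.Empty using (⊥)
open import Relation.Nullary.Decidable using (⌊_⌋)
open import Relation.Binary.PropositionalEquality using (_≡_)

-- directed version of the edge set: {a, a+1} for a+1 ≤ n-2
-- (i.e. {i,i+1}, 0≤i≤n-4, and {n-3,n-2}), and {n-3, n-1}.
DEdge : ℕ → ℕ → ℕ → Set
DEdge n a b = (b ≡ suc a × b ℕ.≤ n ∸ 2) ⊎ (a ≡ n ∸ 3 × b ≡ n ∸ 1)

Adj : (n : ℕ) → Fin n → Fin n → Set
Adj n i j = DEdge n (toℕ i) (toℕ j) ⊎ DEdge n (toℕ j) (toℕ i)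

-- An orientation of D_n (automatically acyclic, D_n being a tree):
-- every diagram edge carries exactly one arrow, arrows only on edges.
record Orientation (n : ℕ) : Set where
  field
    arr     : Fin n → Fin n → Bool            -- arr i j ≡ true  ⇔  arrow i → j
    arr-adj : ∀ i j → arr i j ≡ true → Adj n i j
    arr-tot : ∀ i j → Adj n i j → arr i j ≡ true ⊎ arr j i ≡ true
    arr-asy : ∀ i j → arr i j ≡ true → arr j i ≡ false
open Orientation public

data Reach {n : ℕ} (S : Fin n → Bool) (x : Fin n) : Fin n → Set where
  here : Reach S x x
  step : ∀ {y z} → Reach S x y → Adj n y z → S z ≡ true → Reach S x z

Connected : {n : ℕ} → (Fin n → Bool) → Set
Connected {n} S = ∀ x y → S x ≡ true → S y ≡ true → Reach S x y

indicator : {n : ℕ} → (Fin n → Bool) → Fin n → ℤ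
indicator S k = if S k then 1ℤ else 0ℤ

rootTwo : (n i j : ℕ) → Fin n → ℤ
rootTwo n i j k =
  if toℕ k <ᵇ i then 0ℤ
  else if toℕ k <ᵇ j then 1ℤ
  else if toℕ k ≤ᵇ n ∸ 3 then + 2
  else 1ℤ

data IsPosRoot (n : ℕ) (d : Fin n → ℤ) : Set where
  connRoot : (S : Fin n → Bool) → (∃ λ k → S k ≡ true) → Connected S →
             (∀ k → d k ≡ indicator S k) → IsPosRoot n d
  twoRoot  : (i j : ℕ) → i ℕ.< j → j ℕ.≤ n ∸ 3 →
             (∀ k → d k ≡ rootTwo n i j k) → IsPosRoot n d

-- Tiled bipartite graphs.  Vertices Fin V, colour black/white, each tile
-- given by its boundary vertices listed in clockwise cyclic order.

record TileGraph (n : ℕ) : Set where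
  field
    V     : ℕ
    black : Fin V → Bool
    tile  : Fin n → List (Fin V)
open TileGraph public

consec : {V : ℕ} → List (Fin V) → Fin V → Fin V → Bool
consec (x ∷ y ∷ l) u v = (⌊ x ≟ u ⌋ ∧ ⌊ y ≟ v ⌋) ∨ consec (y ∷ l) u v
consec _ _ _ = false

cyc : {A : Set} → List A → List A
cyc [] = []
cyc (x ∷ xs) = x ∷ xs ++ [ x ]

cycStep : {n : ℕ} (G : TileGraph n) → Fin n → Fin (V G) → Fin (V G) → Bool
cycStep G k = consec (cyc (tile G k))

inTile : {n : ℕ} (G : TileGraph n) → Fin n → Fin (V G) → Fin (V G) → Bool
inTile G k u v = cycStep G k u v ∨ cycStep G k v u

sumFin : {n : ℕ} → (Fin n → ℕ) → ℕ
sumFin {n} f = sum (map f (allFin n))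

ind : Bool → ℕ
ind b = if b then 1 else 0

countIn : {n : ℕ} (G : TileGraph n) → (Fin n → Bool) → Fin (V G) → Fin (V G) → ℕ
countIn G H b w = sumFin (λ k → ind (H k ∧ inTile G k b w))

countBW : {n : ℕ} (G : TileGraph n) → (Fin n → Bool) → Fin (V G) → Fin (V G) → ℕ
countBW G H b w = sumFin (λ k → ind (H k ∧ cycStep G k b w))

-- {b,w} (b black, w white) is a boundary edge of the union H of tiles
-- (lies in exactly one tile of H), and it is black-to-white when the
-- boundary of H is traversed clockwise (i.e. in the clockwise orientation
-- of the unique tile of H containing it).
bwBoundary : {n : ℕ} (G : TileGraph n) → (Fin n → Bool) → Fin (V G) → Fin (V G) → Bool
bwBoundary G H b w = (countIn G H b w ≡ᵇ 1) ∧ (countBW G H b w ≡ᵇ 1)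

record IsBaseGraph {n : ℕ} (Q : Orientation n) (G : TileGraph n) : Set where
  field
    hexagon   : ∀ k → toℕ k ≡ n ∸ 3 → length (tile G k) ≡ 6
    squares   : ∀ k → (toℕ k ≡ n ∸ 3 → ⊥) → length (tile G k) ≡ 4
    distinct  : ∀ k → Unique (tile G k)
    bipartite : ∀ k u v → cycStep G k u v ≡ true → (black G u ≡ true × black G v ≡ false)
                                                   ⊎ (black G u ≡ false × black G v ≡ true)
    share     : ∀ i j → (i ≡ j → ⊥) →
                  ((Σ (Fin (V G)) λ u → Σ (Fin (V G)) λ v →
                      inTile G i u v ≡ true × inTile G j u v ≡ true)
                   → Adj n i j)
                × (Adj n i j → Σ (Fin (V G)) λ u → Σ (Fin (V G)) λ v →
                      inTile G i u v ≡ true × inTile G j u v ≡ true)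
    arrowBW   : ∀ i j b w → arr Q i j ≡ true → black G b ≡ true →
                  inTile G i b w ≡ true → inTile G j b w ≡ true →
                  cycStep G i b w ≡ true

-- Weights.  A weight function assigns an integer to each pair (b , w);
-- an edge {b,w} with b black, w white is recorded at (b , w).

Weight : {n : ℕ} → TileGraph n → Set
Weight G = Fin (V G) → Fin (V G) → ℤ

intInd : Bool → ℤ
intInd b = if b then 1ℤ else 0ℤ

-- M_- = M_1 ⊔ M_2 ; initial weight = multiplicity in M_-
initWeight : {n : ℕ} (G : TileGraph n) → (Fin n → ℤ) → Weight G
initWeight G d b w =
  + (ind (bwBoundary G H1 b w) ℕ.+ ind (bwBoundary G H2 b w))
  where
    H1 = λ k → ⌊ 1ℤ ℤ.≤? d k ⌋
    H2 = λ k → ⌊ d k ℤ.≟ + 2 ⌋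

flipAt : {n : ℕ} (G : TileGraph n) → Fin n → Weight G → Weight G
flipAt G i W b w = W b w - intInd (cycStep G i b w) + intInd (cycStep G i w b)

iter : {A : Set} → ℕ → (A → A) → A → A
iter zero f x = x
iter (suc m) f x = f (iter m f x)

flips : {n : ℕ} (G : TileGraph n) → (Fin n → ℤ) → Weight G → Weight G
flips {n} G e W = foldr (λ k acc → iter ℤ.∣ e k ∣ (flipAt G k) acc) W (allFin n)

-- A boundary edge lies in a single tile i, so flips at the other tiles leave its weight unchanged,
-- while each of the e_i flips at tile i moves it by -1 or +1 according to its orientation in tile i
-- (never both: a square or hexagon has no edge traversed in both directions). Initially the edge
-- lies in M₁ (resp. M₂) iff it is black-to-white in tile i and d_i ≥ 1 (resp. d_i = 2); as
-- d_i ∈ {0, 1, 2}, its multiplicity is max(d_i, 0) in that case and 0 = max(-d_i, 0) otherwise.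
module Submission where

open import Defs
open import Data.Nat using (ℕ; _≤_)
open import Data.Fin using (Fin)
open import Data.Integer using (ℤ; 0ℤ; _⊔_; -_; _-_; _+_) renaming (_≤_ to _≤ℤ_)
open import Data.Product using (_×_)
open import Data.Bool using (true; false)
open import Relation.Binary.PropositionalEquality using (_≡_)

open import Data.Bool using (_∧_; _∨_; if_then_else_)
open import Data.Bool.Properties using (∧-zeroʳ; ∨-conicalˡ; ∨-conicalʳ; ¬-not)
open import Data.Nat as ℕ using (zero; suc; z≤n; s≤s)
open import Data.Nat.Properties using (+-monoʳ-≤; m≤m+n; m≤n+m; +-comm; ≤-trans; n≤0⇒n≡0; m+n≤o⇒m≤o∸n) renaming (+-identityʳ to +-identityʳ-ℕ)
open import Data.Fin as Fin using (toℕ; _≟_)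
open import Data.Fin.Properties using (suc-injective)
open import Data.List using (List; []; _∷_; _++_; [_]; _∷ʳ_; length; map; foldr; tabulate; allFin)
open import Data.List.Properties using (map-tabulate; foldr-map)
open import Data.List.Membership.Propositional using (_∈_)
open import Data.List.Relation.Unary.Any using (here; there)
open import Data.List.Relation.Unary.All using ([]; _∷_)
open import Data.List.Relation.Unary.All.Properties using (All¬⇒¬Any)
open import Data.List.Relation.Unary.AllPairs using ([]; _∷_)
open import Data.List.Relation.Unary.Unique.Propositional using (Unique)
open import Data.List.Relation.Unary.Unique.Propositional.Properties using (++⁺)
open import Data.Integer as ℤ using (+_; 1ℤ; ∣_∣; _*_)
open import Data.Integer.Properties using (0≤i⇒+∣i∣≡i; *-zeroˡ; *-zeroʳ; +-identityʳ; pos-+)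
open import Data.Integer.Tactic.RingSolver using (solve-∀)
open import Data.Empty using (⊥-elim)
open import Data.Product using (_,_; proj₁; proj₂)
open import Relation.Nullary using (¬_; yes; no)
open import Relation.Nullary.Decidable using (⌊_⌋)
open import Relation.Binary.PropositionalEquality using (_≢_; refl; sym; trans; cong; cong₂; subst; subst₂; module ≡-Reasoning)
open import Function using (id; _∘_)

data Consecutive {A : Set} : List A → A → A → Set where
  here  : ∀ {x y l} → Consecutive (x ∷ y ∷ l) x y
  there : ∀ {x y l u v} → Consecutive (y ∷ l) u v → Consecutive (x ∷ y ∷ l) u v

Consecutive⇒∈ˡ : ∀ {A : Set} {l : List A} {u v} → Consecutive l u v → u ∈ l
Consecutive⇒∈ˡ here      = here refl
Consecutive⇒∈ˡ (there c) = there (Consecutive⇒∈ˡ c)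

Consecutive⇒∈ʳ : ∀ {A : Set} {l : List A} {u v} → Consecutive l u v → v ∈ l
Consecutive⇒∈ʳ here      = there (here refl)
Consecutive⇒∈ʳ (there c) = there (Consecutive⇒∈ʳ c)

Consecutive-head : ∀ {A : Set} {x y : A} {l v} → Unique (x ∷ y ∷ l) →
                   Consecutive (x ∷ y ∷ l) x v → v ≡ y
Consecutive-head _        here      = refl
Consecutive-head (x∉ ∷ _) (there c) = ⊥-elim (All¬⇒¬Any x∉ (Consecutive⇒∈ˡ c))

Consecutive-asym : ∀ {A : Set} {l : List A} {u v} → Unique l →
                   Consecutive l u v → ¬ Consecutive l v u
Consecutive-asym ((x≢y ∷ _) ∷ _) here      here      = x≢y refl
Consecutive-asym (x∉ ∷ _)        here      (there c) = All¬⇒¬Any x∉ (Consecutive⇒∈ʳ c)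
Consecutive-asym (x∉ ∷ _)        (there c) here      = All¬⇒¬Any x∉ (Consecutive⇒∈ʳ c)
Consecutive-asym (_ ∷ u)         (there c) (there d) = Consecutive-asym u c d

Unique-∷ʳ : ∀ {A : Set} {xs : List A} {x} → Unique xs → ¬ x ∈ xs → Unique (xs ∷ʳ x)
Unique-∷ʳ u x∉ = ++⁺ u ([] ∷ []) λ where (x∈ , here refl) → x∉ x∈

-- The wrap-around pair (last, x) of cyc (x ∷ xs) reverses a pair of x ∷ xs only when the length is 2.
cyc-Consecutive-asym : ∀ {A : Set} (l : List A) {u v} → Unique l → 3 ≤ length l →
                       Consecutive (cyc l) u v → ¬ Consecutive (cyc l) v u
cyc-Consecutive-asym []                     _ ()
cyc-Consecutive-asym (_ ∷ [])               _ (s≤s ())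
cyc-Consecutive-asym (_ ∷ _ ∷ [])           _ (s≤s (s≤s ()))
cyc-Consecutive-asym (x ∷ y₁ ∷ y₂ ∷ ys) ((x≢y₁ ∷ x≢y₂ ∷ x∉ys) ∷ u) _ = asym
  where
    tail-unique : Unique (y₁ ∷ y₂ ∷ ys ++ [ x ])
    tail-unique = Unique-∷ʳ u (All¬⇒¬Any (x≢y₁ ∷ x≢y₂ ∷ x∉ys))
    wrap : ¬ Consecutive (y₁ ∷ y₂ ∷ ys ++ [ x ]) y₁ x
    wrap c = x≢y₂ (Consecutive-head tail-unique c)
    asym : ∀ {u v} → Consecutive (x ∷ y₁ ∷ y₂ ∷ ys ++ [ x ]) u v →
           ¬ Consecutive (x ∷ y₁ ∷ y₂ ∷ ys ++ [ x ]) v u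
    asym here      here      = x≢y₁ refl
    asym here      (there d) = wrap d
    asym (there c) here      = wrap c
    asym (there c) (there d) = Consecutive-asym tail-unique c d

consec⇒Consecutive : ∀ {V} (l : List (Fin V)) {u v} → consec l u v ≡ true → Consecutive l u v
consec⇒Consecutive []      ()
consec⇒Consecutive (_ ∷ []) ()
consec⇒Consecutive (x ∷ y ∷ l) {u} {v} eq
  with x ≟ u | y ≟ v | consec⇒Consecutive (y ∷ l) {u} {v}
... | yes refl | yes refl | _   = here
... | yes _    | no _     | rec = there (rec eq)
... | no _     | _        | rec = there (rec eq)

module _ {n} {Q : Orientation n} {G : TileGraph n} (base : IsBaseGraph Q G) where
  open IsBaseGraph base

  3≤length-tile : ∀ k → 3 ≤ length (tile G k)
  3≤length-tile k with toℕ k ℕ.≟ n ℕ.∸ 3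
  ... | yes hex = subst (3 ≤_) (sym (hexagon k hex)) (s≤s (s≤s (s≤s z≤n)))
  ... | no  sq  = subst (3 ≤_) (sym (squares k sq)) (s≤s (s≤s (s≤s z≤n)))

  cycStep-asym : ∀ k {u v} → cycStep G k u v ≡ true → cycStep G k v u ≡ false
  cycStep-asym k uv = ¬-not λ vu →
    cyc-Consecutive-asym (tile G k) (distinct k) (3≤length-tile k)
      (consec⇒Consecutive _ uv) (consec⇒Consecutive _ vu)

foldr-allFin-suc : ∀ {A : Set} {n} (F : Fin (suc n) → A → A) x →
                   foldr F x (allFin (suc n)) ≡ F Fin.zero (foldr (F ∘ Fin.suc) x (allFin n))
foldr-allFin-suc {n = n} F x = cong (F Fin.zero) (begin
  foldr F x (tabulate Fin.suc)        ≡⟨ cong (foldr F x) (map-tabulate id Fin.suc) ⟨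
  foldr F x (map Fin.suc (allFin n))  ≡⟨ foldr-map F Fin.suc x (allFin n) ⟩
  foldr (F ∘ Fin.suc) x (allFin n)    ∎)
  where open ≡-Reasoning

foldr-allFin-invariant : ∀ {A B : Set} {n} (F : Fin n → A → A) (obs : A → B) →
                         (∀ k a → obs (F k a) ≡ obs a) →
                         ∀ x → obs (foldr F x (allFin n)) ≡ obs x
foldr-allFin-invariant {n = zero}  F obs inv x = refl
foldr-allFin-invariant {n = suc n} F obs inv x
  rewrite foldr-allFin-suc F x
  = trans (inv Fin.zero _) (foldr-allFin-invariant (F ∘ Fin.suc) obs (inv ∘ Fin.suc) x)

foldr-allFin-single : ∀ {A B : Set} {n} (F : Fin n → A → A) (obs : A → B) (i : Fin n) (f : B → B) →
                      (∀ k → k ≢ i → ∀ a → obs (F k a) ≡ obs a) →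
                      (∀ a → obs (F i a) ≡ f (obs a)) →
                      ∀ x → obs (foldr F x (allFin n)) ≡ f (obs x)
foldr-allFin-single {n = suc n} F obs Fin.zero f inv at-i x
  rewrite foldr-allFin-suc F x
  = trans (at-i _) (cong f (foldr-allFin-invariant (F ∘ Fin.suc) obs (λ k → inv (Fin.suc k) λ ()) x))
foldr-allFin-single {n = suc n} F obs (Fin.suc i) f inv at-i x
  rewrite foldr-allFin-suc F x
  = trans (inv Fin.zero (λ ()) _)
          (foldr-allFin-single (F ∘ Fin.suc) obs i f
            (λ k k≢i → inv (Fin.suc k) (k≢i ∘ suc-injective)) at-i x)

sumFin-foldr : ∀ {n} (g : Fin n → ℕ) → sumFin g ≡ foldr (λ k s → g k ℕ.+ s) 0 (allFin n)
sumFin-foldr {n} g = foldr-map ℕ._+_ g 0 (allFin n)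

sumFin-suc : ∀ {n} (g : Fin (suc n) → ℕ) → sumFin g ≡ g Fin.zero ℕ.+ sumFin (g ∘ Fin.suc)
sumFin-suc g = trans (sumFin-foldr g) (trans
  (foldr-allFin-suc (λ k s → g k ℕ.+ s) 0)
  (cong (g Fin.zero ℕ.+_) (sym (sumFin-foldr (g ∘ Fin.suc)))))

sumFin-supported : ∀ {n} (g : Fin n → ℕ) (i : Fin n) → (∀ k → k ≢ i → g k ≡ 0) → sumFin g ≡ g i
sumFin-supported g i vanish = trans (sumFin-foldr g) (trans
  (foldr-allFin-single (λ k s → g k ℕ.+ s) id i (g i ℕ.+_) (λ k k≢i s → cong (ℕ._+ s) (vanish k k≢i))
    (λ _ → refl) 0)
  (+-identityʳ-ℕ (g i)))

sumFin-≥ : ∀ {n} (g : Fin n → ℕ) k → g k ≤ sumFin g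
sumFin-≥ g Fin.zero    rewrite sumFin-suc g = m≤m+n _ _
sumFin-≥ g (Fin.suc k) rewrite sumFin-suc g = ≤-trans (sumFin-≥ (g ∘ Fin.suc) k) (m≤n+m _ _)

sumFin-pair : ∀ {n} (g : Fin n → ℕ) k i → k ≢ i → g k ℕ.+ g i ≤ sumFin g
sumFin-pair g Fin.zero    Fin.zero    k≢i = ⊥-elim (k≢i refl)
sumFin-pair g Fin.zero    (Fin.suc i) _   rewrite sumFin-suc g =
  +-monoʳ-≤ (g Fin.zero) (sumFin-≥ (g ∘ Fin.suc) i)
sumFin-pair g (Fin.suc k) Fin.zero    _   rewrite sumFin-suc g | +-comm (g (Fin.suc k)) (g Fin.zero) =
  +-monoʳ-≤ (g Fin.zero) (sumFin-≥ (g ∘ Fin.suc) k)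
sumFin-pair g (Fin.suc k) (Fin.suc i) k≢i rewrite sumFin-suc g =
  ≤-trans (sumFin-pair (g ∘ Fin.suc) k i (k≢i ∘ cong Fin.suc)) (m≤n+m _ _)

sumFin≡1⇒others≡0 : ∀ {n} (g : Fin n → ℕ) i → sumFin g ≡ 1 → g i ≡ 1 → ∀ k → k ≢ i → g k ≡ 0
sumFin≡1⇒others≡0 g i sum≡1 gi≡1 k k≢i =
  n≤0⇒n≡0 (m+n≤o⇒m≤o∸n (g k) (subst₂ (λ a s → g k ℕ.+ a ≤ s) gi≡1 sum≡1 (sumFin-pair g k i k≢i)))

ind≡0⇒false : ∀ x → ind x ≡ 0 → x ≡ false
ind≡0⇒false false _ = refl

flipShift : ∀ {n} (G : TileGraph n) → Fin n → Fin (V G) → Fin (V G) → ℤ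
flipShift G k b w = intInd (cycStep G k w b) - intInd (cycStep G k b w)

iter-flipAt : ∀ {n} (G : TileGraph n) k b w m (W : Weight G) →
              iter m (flipAt G k) W b w ≡ W b w + + m * flipShift G k b w
iter-flipAt G k b w zero W =
  sym (trans (cong (λ c → W b w + c) (*-zeroˡ (flipShift G k b w))) (+-identityʳ (W b w)))
iter-flipAt G k b w (suc m) W = begin
  iter m (flipAt G k) W b w - p + q          ≡⟨ cong (λ x → x - p + q) (iter-flipAt G k b w m W) ⟩
  W b w + + m * (q - p) - p + q              ≡⟨ one-more-flip (W b w) (+ m) p q ⟩
  W b w + (1ℤ + + m) * (q - p)               ≡⟨ cong (λ c → W b w + c * (q - p)) (pos-+ 1 m) ⟨
  W b w + + suc m * (q - p)                  ∎
  where
    open ≡-Reasoning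
    p = intInd (cycStep G k b w)
    q = intInd (cycStep G k w b)
    one-more-flip : ∀ x m p q → x + m * (q - p) - p + q ≡ x + (1ℤ + m) * (q - p)
    one-more-flip = solve-∀

data RootCoeff : ℤ → Set where
  coeff₀ : RootCoeff 0ℤ
  coeff₁ : RootCoeff 1ℤ
  coeff₂ : RootCoeff (+ 2)

indicator-coeff : ∀ s → RootCoeff (if s then 1ℤ else 0ℤ)
indicator-coeff true  = coeff₁
indicator-coeff false = coeff₀

rootTwo-coeff : ∀ a b c → RootCoeff (if a then 0ℤ else if b then 1ℤ else if c then + 2 else 1ℤ)
rootTwo-coeff true  _     _     = coeff₀
rootTwo-coeff false true  _     = coeff₁
rootTwo-coeff false false true  = coeff₂
rootTwo-coeff false false false = coeff₁

posRoot-coeff : ∀ {n} {d : Fin n → ℤ} → IsPosRoot n d → ∀ k → RootCoeff (d k)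
posRoot-coeff (connRoot S _ _ d≡) k = subst RootCoeff (sym (d≡ k)) (indicator-coeff (S k))
posRoot-coeff {n} (twoRoot i j _ _ d≡) k = subst RootCoeff (sym (d≡ k))
  (rootTwo-coeff (toℕ k ℕ.<ᵇ i) (toℕ k ℕ.<ᵇ j) (toℕ k ℕ.≤ᵇ n ℕ.∸ 3))

multiplicity-M₋ : ∀ {z} → RootCoeff z → ∀ c →
                  + (ind (⌊ 1ℤ ℤ.≤? z ⌋ ∧ c) ℕ.+ ind (⌊ z ℤ.≟ + 2 ⌋ ∧ c))
                    ≡ (if c then z ⊔ 0ℤ else (- z) ⊔ 0ℤ)
multiplicity-M₋ coeff₀ true  = refl
multiplicity-M₋ coeff₁ true  = refl
multiplicity-M₋ coeff₂ true  = refl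
multiplicity-M₋ coeff₀ false = refl
multiplicity-M₋ coeff₁ false = refl
multiplicity-M₋ coeff₂ false = refl

OnlyInTile : ∀ {n} (G : TileGraph n) → Fin n → Fin (V G) → Fin (V G) → Set
OnlyInTile G i b w = ∀ k → k ≢ i → inTile G k b w ≡ false

boundaryEdge⇒OnlyInTile : ∀ {n} (G : TileGraph n) {i b w} →
                          countIn G (λ _ → true) b w ≡ 1 → inTile G i b w ≡ true → OnlyInTile G i b w
boundaryEdge⇒OnlyInTile G {i} {b} {w} count≡1 inI k k≢i =
  ind≡0⇒false _ (sumFin≡1⇒others≡0 (λ k → ind (inTile G k b w)) i count≡1 (cong ind inI) k k≢i)

bwBoundary-truthTable : ∀ h c c′ → ((ind (h ∧ (c ∨ c′)) ℕ.≡ᵇ 1) ∧ (ind (h ∧ c) ℕ.≡ᵇ 1)) ≡ h ∧ c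
bwBoundary-truthTable false _     _     = refl
bwBoundary-truthTable true  true  _     = refl
bwBoundary-truthTable true  false true  = refl
bwBoundary-truthTable true  false false = refl

module _ {n} (G : TileGraph n) {i b w} (only : OnlyInTile G i b w) where

  cycStep-elsewhere : ∀ k → k ≢ i → cycStep G k b w ≡ false × cycStep G k w b ≡ false
  cycStep-elsewhere k k≢i = ∨-conicalˡ _ _ (only k k≢i) , ∨-conicalʳ _ _ (only k k≢i)

  countIn-only : ∀ H → countIn G H b w ≡ ind (H i ∧ inTile G i b w)
  countIn-only H = sumFin-supported _ i λ k k≢i →
    cong ind (trans (cong (H k ∧_) (only k k≢i)) (∧-zeroʳ (H k)))

  countBW-only : ∀ H → countBW G H b w ≡ ind (H i ∧ cycStep G i b w)
  countBW-only H = sumFin-supported _ i λ k k≢i →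
    cong ind (trans (cong (H k ∧_) (proj₁ (cycStep-elsewhere k k≢i))) (∧-zeroʳ (H k)))

  bwBoundary-only : ∀ H → bwBoundary G H b w ≡ H i ∧ cycStep G i b w
  bwBoundary-only H rewrite countIn-only H | countBW-only H =
    bwBoundary-truthTable (H i) (cycStep G i b w) (cycStep G i w b)

  flips-only : ∀ e W → flips G e W b w ≡ W b w + + ∣ e i ∣ * flipShift G i b w
  flips-only e W = foldr-allFin-single (λ k → iter ∣ e k ∣ (flipAt G k)) (λ W → W b w) i
    (λ x → x + + ∣ e i ∣ * flipShift G i b w)
    unchanged (iter-flipAt G i b w ∣ e i ∣) W
    where
      unchanged : ∀ k → k ≢ i → ∀ W → iter ∣ e k ∣ (flipAt G k) W b w ≡ W b w
      unchanged k k≢i W rewrite iter-flipAt G k b w ∣ e k ∣ W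
                              | proj₁ (cycStep-elsewhere k k≢i) | proj₂ (cycStep-elsewhere k k≢i)
        = trans (cong (λ c → W b w + c) (*-zeroʳ (+ ∣ e k ∣))) (+-identityʳ (W b w))

  initWeight-only : ∀ {d} → IsPosRoot n d →
                    initWeight G d b w ≡ (if cycStep G i b w then d i ⊔ 0ℤ else (- d i) ⊔ 0ℤ)
  initWeight-only root = trans
    (cong₂ (λ p q → + (ind p ℕ.+ ind q)) (bwBoundary-only _) (bwBoundary-only _))
    (multiplicity-M₋ (posRoot-coeff root i) (cycStep G i b w))

  flips-initWeight-bw : ∀ {d} e → IsPosRoot n d → cycStep G i b w ≡ true → cycStep G i w b ≡ false →
                        flips G e (initWeight G d) b w ≡ (d i ⊔ 0ℤ) - + ∣ e i ∣
  flips-initWeight-bw {d} e root bw wb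
    rewrite flips-only e (initWeight G d) | initWeight-only root | bw | wb = down (d i ⊔ 0ℤ) (+ ∣ e i ∣)
    where
      down : ∀ x y → x + y * (0ℤ - 1ℤ) ≡ x - y
      down = solve-∀

  flips-initWeight-wb : ∀ {d} e → IsPosRoot n d → cycStep G i b w ≡ false → cycStep G i w b ≡ true →
                        flips G e (initWeight G d) b w ≡ ((- d i) ⊔ 0ℤ) + + ∣ e i ∣
  flips-initWeight-wb {d} e root bw wb
    rewrite flips-only e (initWeight G d) | initWeight-only root | bw | wb = up ((- d i) ⊔ 0ℤ) (+ ∣ e i ∣)
    where
      up : ∀ x y → x + y * (1ℤ - 0ℤ) ≡ x + y
      up = solve-∀

lemma4p2 : (n : ℕ) → 4 ≤ n → (Q : Orientation n) → (G : TileGraph n) → IsBaseGraph Q G →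
    (d : Fin n → ℤ) → IsPosRoot n d →
    (e : Fin n → ℤ) → (∀ k → (0ℤ ≤ℤ e k) × (e k ≤ℤ d k)) →
    (b w : Fin (V G)) → black G b ≡ true → black G w ≡ false →
    countIn G (λ _ → true) b w ≡ 1 →
    (i : Fin n) → inTile G i b w ≡ true →
    (cycStep G i b w ≡ true → flips G e (initWeight G d) b w ≡ (d i ⊔ 0ℤ) - e i)
    × (cycStep G i w b ≡ true → flips G e (initWeight G d) b w ≡ ((- d i) ⊔ 0ℤ) + e i)
lemma4p2 n _ _ G base d root e e-bounds b w _ _ count≡1 i inI = bw-case , wb-case
  where
    only : OnlyInTile G i b w
    only = boundaryEdge⇒OnlyInTile G count≡1 inI

    ∣eᵢ∣≡eᵢ : + ∣ e i ∣ ≡ e i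
    ∣eᵢ∣≡eᵢ = 0≤i⇒+∣i∣≡i (proj₁ (e-bounds i))

    bw-case : cycStep G i b w ≡ true → flips G e (initWeight G d) b w ≡ (d i ⊔ 0ℤ) - e i
    bw-case bw = trans (flips-initWeight-bw G only e root bw (cycStep-asym base i bw))
                       (cong (_-_ (d i ⊔ 0ℤ)) ∣eᵢ∣≡eᵢ)

    wb-case : cycStep G i w b ≡ true → flips G e (initWeight G d) b w ≡ ((- d i) ⊔ 0ℤ) + e i
    wb-case wb = trans (flips-initWeight-wb G only e root (cycStep-asym base i wb) wb)
                       (cong (_+_ ((- d i) ⊔ 0ℤ)) ∣eᵢ∣≡eᵢ)
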